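{- Let $G$ be a graph and $W$ a set of its vertices. Any two applicable combinatorial reduction strategies of $G$ with domain $W$ apply the negative rule $\mathrm{gnr}$ the same number of times.
   Context: A graph is a finite graph with vertex set $V$, no multiple edges, in which each vertex may or may not carry a loop. Its adjacency matrix $A$ is the symmetric $V\times V$ matrix over $\mathbf{F}_2$ with $A_{vw}=1$ iff $v\ne w$ are adjacent and $A_{vv}=1$ iff $v$ has a loop. Combinatorial reduction rules (domain listed first in block form, arithmetic over $\mathbf{F}_2$): $\mathrm{gpr}_v$ applies iff $v$ has a loop; domain $\{v\}$; if $A=\begin{pmatrix}1&q\\ q^T&R\end{pmatrix}$, the result is the graph on $V\setminus\{v\}$ with adjacency matrix $R-q^Tq$. $\mathrm{gdr}_{v_1,v_2}$ applies iff $v_1\neq v_2$ are loopless and adjacent; domain $\{v_1,v_2\}$; if $A=\begin{pmatrix}J&Q\\ Q^T&R\end{pmatrix}$ with $J=\begin{pmatrix}0&1\\1&0\end{pmatrix}$, the result is the graph on $V\setminus\{v_1,v_2\}$ with adjacency matrix $R-Q^TJQ$. $\mathrm{gnr}_v$ (negative rule) applies iff $v$ is loopless with no neighbours; domain $\{v\}$; the result is $G$ with $v$ deleted. A combinatorial reduction strategy is a sequence $(\gamma_1,\dots,\gamma_k)$ of rules; it is applicable if each $\gamma_i$ applies to $\gamma_{i-1}\circ\cdots\circ\gamma_1(G)$; its domain is the set of all vertices removed. -}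

module Defs where

open import Data.Nat using (ℕ; zero; suc; _+_)
open import Data.Fin using (Fin; _≟_)
open import Data.Bool using (Bool; true; false; _∧_; _xor_; not; if_then_else_)
open import Data.List using (List; []; _∷_)
open import Relation.Nullary using (¬_)
open import Relation.Nullary.Decidable using (⌊_⌋)
open import Relation.Binary.PropositionalEquality using (_≡_)

-- A graph on the vertex set Fin n (any finite vertex set, up to relabelling):
-- adjacency matrix over F₂ = Bool (xor = +, ∧ = ·); A v v = true iff v has a loop.
Matrix : ℕ → Set
Matrix n = Fin n → Fin n → Bool

Symmetric : ∀ {n} → Matrix n → Set
Symmetric A = ∀ v w → A v w ≡ A w v

-- An intermediate graph during a reduction: the set of vertices still present
-- (a subset of Fin n) together with an adjacency matrix; only entries between
-- present vertices are meaningful.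
record State (n : ℕ) : Set where
  constructor state
  field
    present : Fin n → Bool
    adj     : Matrix n
open State public

initial : ∀ {n} → Matrix n → State n
initial A = state (λ _ → true) A

delete : ∀ {n} → Fin n → (Fin n → Bool) → (Fin n → Bool)
delete v P x = if ⌊ x ≟ v ⌋ then false else P x

-- gpr_v : new matrix R - qᵀq, i.e. A' x y = A x y + A v x · A v y
gprResult : ∀ {n} → State n → Fin n → State n
gprResult S v = state (delete v (present S))
  (λ x y → adj S x y xor (adj S v x ∧ adj S v y))

-- gdr_{v1,v2} : new matrix R - Qᵀ J Q,
-- (QᵀJQ)_{xy} = A v1 x · A v2 y + A v2 x · A v1 y
gdrResult : ∀ {n} → State n → Fin n → Fin n → State n
gdrResult S v₁ v₂ = state (delete v₂ (delete v₁ (present S)))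
  (λ x y → adj S x y xor ((adj S v₁ x ∧ adj S v₂ y) xor (adj S v₂ x ∧ adj S v₁ y)))

gnrResult : ∀ {n} → State n → Fin n → State n
gnrResult S v = state (delete v (present S)) (adj S)

data Rule (n : ℕ) : Set where
  gpr : Fin n → Rule n
  gdr : Fin n → Fin n → Rule n
  gnr : Fin n → Rule n

data Step {n : ℕ} (S : State n) : Rule n → State n → Set where
  gpr-step : ∀ {v} → present S v ≡ true → adj S v v ≡ true →
             Step S (gpr v) (gprResult S v)
  gdr-step : ∀ {v₁ v₂} → ¬ (v₁ ≡ v₂) →
             present S v₁ ≡ true → present S v₂ ≡ true →
             adj S v₁ v₁ ≡ false → adj S v₂ v₂ ≡ false →
             adj S v₁ v₂ ≡ true →
             Step S (gdr v₁ v₂) (gdrResult S v₁ v₂)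
  gnr-step : ∀ {v} → present S v ≡ true → adj S v v ≡ false →
             (∀ w → present S w ≡ true → ¬ (w ≡ v) → adj S v w ≡ false) →
             Step S (gnr v) (gnrResult S v)

-- Run S σ S' : the strategy σ = (γ₁,…,γₖ) (γ₁ applied first) is applicable
-- to S and produces S'.
data Run {n : ℕ} : State n → List (Rule n) → State n → Set where
  done : ∀ {S} → Run S [] S
  step : ∀ {S S' S'' γ σ} → Step S γ S' → Run S' σ S'' → Run S (γ ∷ σ) S''

-- Starting from the full vertex set, the domain (set of removed vertices)
-- of a run ending in F is {v | present F v ≡ false}.
HasDomain : ∀ {n} → State n → (Fin n → Bool) → Set
HasDomain F W = ∀ v → present F v ≡ not (W v)

countGnr : ∀ {n} → List (Rule n) → ℕ
countGnr [] = 0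
countGnr (gnr _ ∷ σ) = suc (countGnr σ)
countGnr (gpr _ ∷ σ) = countGnr σ
countGnr (gdr _ _ ∷ σ) = countGnr σ

module Submission where

-- The number of applications of the negative rule is an invariant of the
-- graph G and the domain W: it equals the nullity (over F₂) of the principal
-- submatrix A[W].  Instead of ranks we count kernel vectors.
--
-- For a symmetric matrix M and a vertex set T, K(M,T) is the set of vectors
-- x ∈ F₂ⁿ supported on T with (M x)_y = 0 for all y ∈ T, so |K(M,T)| is
-- 2 ^ (nullity of M[T]).  Every count is proved by an involution argument:
-- if a predicate P is invariant under flipping coordinate u and a Boolean
-- functional ℓ is toggled by that flip, then exactly half of P satisfies
-- ℓ = 0 (halving), hence any two such functionals cut out equally many
-- vectors (exchange).  With this, the three rules act on |K| as follows:
--   gpr_v and gdr_{v₁,v₂} (pivots / Schur complements) preserve |K|,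
--   gnr_v (deleting an isolated loopless vertex) halves |K|.
-- Along a run, with T the present vertices of W, |K| therefore equals
-- 2 ^ (number of gnr steps); at the end T = ∅ and |K| = 1.  Both strategies
-- start from the same |K(A,W)|, so they use gnr equally often.

open import Defs
open import Data.Nat using (ℕ; zero; suc; _+_; _*_; _^_; s≤s; z≤n)
open import Data.Nat.Properties
  using (+-comm; +-identityʳ; +-commutativeSemigroup; *-cancelˡ-≡; <-cmp; <-irrefl; ^-monoʳ-<)
open import Algebra.Bundles using (CommutativeRing)
open import Algebra.Properties.CommutativeSemigroup +-commutativeSemigroup
  using () renaming (interchange to +-interchange)
open import Data.Bool using (Bool; true; false; _∧_; _xor_; not; if_then_else_)
open import Data.Bool.Properties
  using (xor-∧-commutativeRing; ∧-assoc; ∧-comm; ∧-zeroʳ; ∧-identityʳ; ∧-inverseˡ; ∧-conicalˡ;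
         ∧-distribˡ-xor; ∧-distribʳ-xor; xor-assoc; xor-comm; xor-same; xor-identityʳ;
         true-xor; not-involutive; not-injective)
  renaming (_≟_ to _≟ᵇ_)
open CommutativeRing xor-∧-commutativeRing
  using () renaming (+-commutativeSemigroup to xor-commutativeSemigroup)
open import Algebra.Properties.CommutativeSemigroup xor-commutativeSemigroup
  using () renaming (interchange to xor-interchange)
open import Data.Fin using (Fin; zero; suc; _≟_)
open import Data.Fin.Properties using (all?)
open import Data.Vec using (Vec; []; _∷_; lookup; updateAt)
open import Data.Vec.Properties
  using (lookup∘updateAt; lookup∘updateAt′; updateAt-updateAt; updateAt-cong; updateAt-id)
open import Data.List using (List; _∷_)
open import Data.Product using (_×_; _,_; proj₁)
open import Data.Sum using (_⊎_; inj₁; inj₂)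
open import Data.Empty using (⊥-elim)
open import Function using (_∘_; id)
open import Function.Bundles using (_⇔_; mk⇔; Equivalence)
open import Relation.Nullary using (¬_; Dec; yes; no; does)
open import Relation.Nullary.Decidable using (¬?; _×-dec_; _→-dec_; _⊎-dec_)
open import Relation.Unary using (Decidable)
open import Relation.Binary.Definitions using (tri<; tri≈; tri>)
open import Relation.Binary.PropositionalEquality
  using (_≡_; _≢_; refl; sym; trans; cong; cong₂; subst; module ≡-Reasoning)

open ≡-Reasoning

flip : ∀ {n} → Fin n → Vec Bool n → Vec Bool n
flip u x = updateAt x u not

flip-involutive : ∀ {n} (u : Fin n) (x : Vec Bool n) → flip u (flip u x) ≡ x
flip-involutive u x = begin
  updateAt (updateAt x u not) u not ≡⟨ updateAt-updateAt u x ⟩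
  updateAt x u (not ∘ not)          ≡⟨ updateAt-cong u not-involutive x ⟩
  updateAt x u id                   ≡⟨ updateAt-id u x ⟩
  x                                 ∎

infix 7 _·_
_·_ : ∀ {n} → (Fin n → Bool) → Vec Bool n → Bool
a · []      = false
a · (b ∷ x) = (a zero ∧ b) xor ((a ∘ suc) · x)

·-xor : ∀ {n} (a c : Fin n → Bool) (x : Vec Bool n) →
        (λ z → a z xor c z) · x ≡ (a · x) xor (c · x)
·-xor a c []      = refl
·-xor a c (b ∷ x) = begin
  ((a zero xor c zero) ∧ b) xor ((λ z → a (suc z) xor c (suc z)) · x)
    ≡⟨ cong₂ _xor_ (∧-distribʳ-xor b (a zero) (c zero)) (·-xor (a ∘ suc) (c ∘ suc) x) ⟩
  ((a zero ∧ b) xor (c zero ∧ b)) xor (((a ∘ suc) · x) xor ((c ∘ suc) · x))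
    ≡⟨ xor-interchange (a zero ∧ b) (c zero ∧ b) _ _ ⟩
  (a · (b ∷ x)) xor (c · (b ∷ x))
    ∎

·-scale : ∀ {n} (s : Bool) (a : Fin n → Bool) (x : Vec Bool n) →
          (λ z → s ∧ a z) · x ≡ s ∧ (a · x)
·-scale s a []      = sym (∧-zeroʳ s)
·-scale s a (b ∷ x) = begin
  ((s ∧ a zero) ∧ b) xor ((λ z → s ∧ a (suc z)) · x)
    ≡⟨ cong₂ _xor_ (∧-assoc s (a zero) b) (·-scale s (a ∘ suc) x) ⟩
  (s ∧ (a zero ∧ b)) xor (s ∧ ((a ∘ suc) · x))
    ≡⟨ ∧-distribˡ-xor s _ _ ⟨
  s ∧ (a · (b ∷ x))
    ∎

·-flip : ∀ {n} (a : Fin n → Bool) (u : Fin n) (x : Vec Bool n) →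
         a · flip u x ≡ (a · x) xor a u
·-flip a zero    (b ∷ x) = toggle (a zero) b ((a ∘ suc) · x)
  where
  toggle : ∀ c b r → (c ∧ not b) xor r ≡ ((c ∧ b) xor r) xor c
  toggle false _     r     = sym (xor-identityʳ r)
  toggle true  true  true  = refl
  toggle true  true  false = refl
  toggle true  false true  = refl
  toggle true  false false = refl
·-flip a (suc u) (b ∷ x) = begin
  (a zero ∧ b) xor ((a ∘ suc) · flip u x)        ≡⟨ cong ((a zero ∧ b) xor_) (·-flip (a ∘ suc) u x) ⟩
  (a zero ∧ b) xor (((a ∘ suc) · x) xor a (suc u)) ≡⟨ xor-assoc (a zero ∧ b) _ _ ⟨
  (a · (b ∷ x)) xor a (suc u)                    ∎

·-vanishes : ∀ {n} (a : Fin n → Bool) (x : Vec Bool n) →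
             (∀ z → a z ∧ lookup x z ≡ false) → a · x ≡ false
·-vanishes a []      _ = refl
·-vanishes a (b ∷ x) h = cong₂ _xor_ (h zero) (·-vanishes (a ∘ suc) x (h ∘ suc))

infix 7 _∙_
_∙_ : ∀ {n} → Matrix n → Vec Bool n → Fin n → Bool
(M ∙ x) y = M y · x

∙-flip-toggles : ∀ {n} (M : Matrix n) {u y : Fin n} → M y u ≡ true →
                 ∀ x → (M ∙ flip u x) y ≡ not ((M ∙ x) y)
∙-flip-toggles M {u} {y} Myu x = begin
  (M ∙ flip u x) y        ≡⟨ ·-flip (M y) u x ⟩
  (M ∙ x) y xor M y u     ≡⟨ cong ((M ∙ x) y xor_) Myu ⟩
  (M ∙ x) y xor true      ≡⟨ xor-comm _ true ⟩
  true xor (M ∙ x) y      ≡⟨ true-xor _ ⟩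
  not ((M ∙ x) y)         ∎

∙-flip-fixes : ∀ {n} (M : Matrix n) {u y : Fin n} → M y u ≡ false →
               ∀ x → (M ∙ flip u x) y ≡ (M ∙ x) y
∙-flip-fixes M {u} {y} Myu x = begin
  (M ∙ flip u x) y        ≡⟨ ·-flip (M y) u x ⟩
  (M ∙ x) y xor M y u     ≡⟨ cong ((M ∙ x) y xor_) Myu ⟩
  (M ∙ x) y xor false     ≡⟨ xor-identityʳ _ ⟩
  (M ∙ x) y               ∎

pivot₁ : ∀ {n} → Matrix n → Fin n → Matrix n
pivot₁ M v a b = M a b xor (M v a ∧ M v b)

pivot₂ : ∀ {n} → Matrix n → Fin n → Fin n → Matrix n
pivot₂ M v₁ v₂ a b = M a b xor ((M v₁ a ∧ M v₂ b) xor (M v₂ a ∧ M v₁ b))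

pivot₁-action : ∀ {n} (M : Matrix n) (v : Fin n) x y →
                (pivot₁ M v ∙ x) y ≡ (M ∙ x) y xor (M v y ∧ (M ∙ x) v)
pivot₁-action M v x y = begin
  (pivot₁ M v ∙ x) y                          ≡⟨ ·-xor (M y) (λ z → M v y ∧ M v z) x ⟩
  (M ∙ x) y xor ((λ z → M v y ∧ M v z) · x)   ≡⟨ cong ((M ∙ x) y xor_) (·-scale (M v y) (M v) x) ⟩
  (M ∙ x) y xor (M v y ∧ (M ∙ x) v)           ∎

pivot₂-action : ∀ {n} (M : Matrix n) (v₁ v₂ : Fin n) x y →
                (pivot₂ M v₁ v₂ ∙ x) y ≡
                (M ∙ x) y xor ((M v₁ y ∧ (M ∙ x) v₂) xor (M v₂ y ∧ (M ∙ x) v₁))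
pivot₂-action M v₁ v₂ x y = begin
  (pivot₂ M v₁ v₂ ∙ x) y
    ≡⟨ ·-xor (M y) (λ z → (M v₁ y ∧ M v₂ z) xor (M v₂ y ∧ M v₁ z)) x ⟩
  (M ∙ x) y xor ((λ z → (M v₁ y ∧ M v₂ z) xor (M v₂ y ∧ M v₁ z)) · x)
    ≡⟨ cong ((M ∙ x) y xor_) (·-xor (λ z → M v₁ y ∧ M v₂ z) (λ z → M v₂ y ∧ M v₁ z) x) ⟩
  (M ∙ x) y xor (((λ z → M v₁ y ∧ M v₂ z) · x) xor ((λ z → M v₂ y ∧ M v₁ z) · x))
    ≡⟨ cong ((M ∙ x) y xor_) (cong₂ _xor_ (·-scale (M v₁ y) (M v₂) x) (·-scale (M v₂ y) (M v₁) x)) ⟩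
  (M ∙ x) y xor ((M v₁ y ∧ (M ∙ x) v₂) xor (M v₂ y ∧ (M ∙ x) v₁))
    ∎

pivot₁-invisible : ∀ {n} (M : Matrix n) (v : Fin n) x → (M ∙ x) v ≡ false →
                   ∀ y → (pivot₁ M v ∙ x) y ≡ (M ∙ x) y
pivot₁-invisible M v x rv y = begin
  (pivot₁ M v ∙ x) y                 ≡⟨ pivot₁-action M v x y ⟩
  (M ∙ x) y xor (M v y ∧ (M ∙ x) v)  ≡⟨ cong (λ b → (M ∙ x) y xor (M v y ∧ b)) rv ⟩
  (M ∙ x) y xor (M v y ∧ false)      ≡⟨ cong ((M ∙ x) y xor_) (∧-zeroʳ (M v y)) ⟩
  (M ∙ x) y xor false                ≡⟨ xor-identityʳ _ ⟩
  (M ∙ x) y                          ∎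

pivot₂-invisible : ∀ {n} (M : Matrix n) (v₁ v₂ : Fin n) x → (M ∙ x) v₁ ≡ false → (M ∙ x) v₂ ≡ false →
                   ∀ y → (pivot₂ M v₁ v₂ ∙ x) y ≡ (M ∙ x) y
pivot₂-invisible M v₁ v₂ x r₁ r₂ y = begin
  (pivot₂ M v₁ v₂ ∙ x) y
    ≡⟨ pivot₂-action M v₁ v₂ x y ⟩
  (M ∙ x) y xor ((M v₁ y ∧ (M ∙ x) v₂) xor (M v₂ y ∧ (M ∙ x) v₁))
    ≡⟨ cong₂ (λ b c → (M ∙ x) y xor ((M v₁ y ∧ b) xor (M v₂ y ∧ c))) r₂ r₁ ⟩
  (M ∙ x) y xor ((M v₁ y ∧ false) xor (M v₂ y ∧ false))
    ≡⟨ cong₂ (λ b c → (M ∙ x) y xor (b xor c)) (∧-zeroʳ (M v₁ y)) (∧-zeroʳ (M v₂ y)) ⟩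
  (M ∙ x) y xor false
    ≡⟨ xor-identityʳ _ ⟩
  (M ∙ x) y
    ∎

pivot₁-column : ∀ {n} (M : Matrix n) (v : Fin n) → Symmetric M → M v v ≡ true →
                ∀ y → pivot₁ M v y v ≡ false
pivot₁-column M v symM Mvv y = begin
  M y v xor (M v y ∧ M v v)   ≡⟨ cong (λ b → M y v xor (M v y ∧ b)) Mvv ⟩
  M y v xor (M v y ∧ true)    ≡⟨ cong (M y v xor_) (trans (∧-identityʳ (M v y)) (symM v y)) ⟩
  M y v xor M y v             ≡⟨ xor-same (M y v) ⟩
  false                       ∎

pivot₂-column₁ : ∀ {n} (M : Matrix n) (v₁ v₂ : Fin n) → Symmetric M →
                 M v₁ v₁ ≡ false → M v₂ v₁ ≡ true → ∀ y → pivot₂ M v₁ v₂ y v₁ ≡ false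
pivot₂-column₁ M v₁ v₂ symM M₁₁ M₂₁ y = begin
  M y v₁ xor ((M v₁ y ∧ M v₂ v₁) xor (M v₂ y ∧ M v₁ v₁))
    ≡⟨ cong₂ (λ b c → M y v₁ xor ((M v₁ y ∧ b) xor (M v₂ y ∧ c))) M₂₁ M₁₁ ⟩
  M y v₁ xor ((M v₁ y ∧ true) xor (M v₂ y ∧ false))
    ≡⟨ cong₂ (λ b c → M y v₁ xor (b xor c)) (∧-identityʳ (M v₁ y)) (∧-zeroʳ (M v₂ y)) ⟩
  M y v₁ xor (M v₁ y xor false)
    ≡⟨ cong (M y v₁ xor_) (trans (xor-identityʳ (M v₁ y)) (symM v₁ y)) ⟩
  M y v₁ xor M y v₁
    ≡⟨ xor-same (M y v₁) ⟩
  false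
    ∎

pivot₂-column₂ : ∀ {n} (M : Matrix n) (v₁ v₂ : Fin n) → Symmetric M →
                 M v₂ v₂ ≡ false → M v₁ v₂ ≡ true → ∀ y → pivot₂ M v₁ v₂ y v₂ ≡ false
pivot₂-column₂ M v₁ v₂ symM M₂₂ M₁₂ y = begin
  M y v₂ xor ((M v₁ y ∧ M v₂ v₂) xor (M v₂ y ∧ M v₁ v₂))
    ≡⟨ cong₂ (λ b c → M y v₂ xor ((M v₁ y ∧ b) xor (M v₂ y ∧ c))) M₂₂ M₁₂ ⟩
  M y v₂ xor ((M v₁ y ∧ false) xor (M v₂ y ∧ true))
    ≡⟨ cong₂ (λ b c → M y v₂ xor (b xor c)) (∧-zeroʳ (M v₁ y)) (∧-identityʳ (M v₂ y)) ⟩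
  M y v₂ xor M v₂ y
    ≡⟨ cong (M y v₂ xor_) (symM v₂ y) ⟩
  M y v₂ xor M y v₂
    ≡⟨ xor-same (M y v₂) ⟩
  false
    ∎

pivot₁-symmetric : ∀ {n} (M : Matrix n) (v : Fin n) → Symmetric M → Symmetric (pivot₁ M v)
pivot₁-symmetric M v symM a b = cong₂ _xor_ (symM a b) (∧-comm (M v a) (M v b))

pivot₂-symmetric : ∀ {n} (M : Matrix n) (v₁ v₂ : Fin n) → Symmetric M →
                   Symmetric (pivot₂ M v₁ v₂)
pivot₂-symmetric M v₁ v₂ symM a b =
  cong₂ _xor_ (symM a b)
    (trans (xor-comm (M v₁ a ∧ M v₂ b) _)
           (cong₂ _xor_ (∧-comm (M v₂ a) (M v₁ b)) (∧-comm (M v₁ a) (M v₂ b))))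

count : ∀ {n} {P : Vec Bool n → Set} → Decidable P → ℕ
count {zero}  P? = if does (P? []) then 1 else 0
count {suc n} P? = count (λ x → P? (true ∷ x)) + count (λ x → P? (false ∷ x))

count-cong : ∀ {n} {P Q : Vec Bool n → Set} {P? : Decidable P} {Q? : Decidable Q} →
             (∀ x → P x ⇔ Q x) → count P? ≡ count Q?
count-cong {zero} {P? = P?} {Q?} P⇔Q with P? [] | Q? []
... | yes _ | yes _ = refl
... | no  _ | no  _ = refl
... | yes p | no ¬q = ⊥-elim (¬q (Equivalence.to (P⇔Q []) p))
... | no ¬p | yes q = ⊥-elim (¬p (Equivalence.from (P⇔Q []) q))
count-cong {suc n} P⇔Q = cong₂ _+_ (count-cong (P⇔Q ∘ (true ∷_))) (count-cong (P⇔Q ∘ (false ∷_)))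

count-none : ∀ {n} {P : Vec Bool n → Set} (P? : Decidable P) → (∀ x → ¬ P x) → count P? ≡ 0
count-none {zero} P? ¬P with P? []
... | yes p = ⊥-elim (¬P [] p)
... | no  _ = refl
count-none {suc n} P? ¬P =
  cong₂ _+_ (count-none (P? ∘ (true ∷_)) (¬P ∘ (true ∷_)))
            (count-none (P? ∘ (false ∷_)) (¬P ∘ (false ∷_)))

count-zeroVector : ∀ {n} (P? : Decidable (λ (x : Vec Bool n) → ∀ y → lookup x y ≡ false)) →
                   count P? ≡ 1
count-zeroVector {zero} P? with P? []
... | yes _ = refl
... | no ¬p = ⊥-elim (¬p λ ())
count-zeroVector {suc n} P? = cong₂ _+_
  (count-none (P? ∘ (true ∷_)) (λ _ isZero → true≢false (isZero zero)))
  (trans (count-cong {P? = P? ∘ (false ∷_)} {Q? = isZero?} tail⇔) (count-zeroVector isZero?))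
  where
  isZero? : Decidable (λ (x : Vec Bool n) → ∀ y → lookup x y ≡ false)
  isZero? x = all? (λ y → lookup x y ≟ᵇ false)
  true≢false : true ≢ false
  true≢false ()
  tail⇔ : ∀ x → (∀ y → lookup (false ∷ x) y ≡ false) ⇔ (∀ y → lookup x y ≡ false)
  tail⇔ x = mk⇔ (λ h y → h (suc y)) (λ { h zero → refl ; h (suc y) → h y })

count-split : ∀ {n} {P Q : Vec Bool n → Set} (P? : Decidable P) (Q? : Decidable Q) →
              count P? ≡ count (λ x → P? x ×-dec Q? x) + count (λ x → P? x ×-dec ¬? (Q? x))
count-split {zero} P? Q? with P? [] | Q? []
... | yes _ | yes _ = refl
... | yes _ | no  _ = refl
... | no  _ | _     = refl
count-split {suc n} P? Q? =
  trans (cong₂ _+_ (count-split (P? ∘ (true ∷_)) (Q? ∘ (true ∷_)))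
                   (count-split (P? ∘ (false ∷_)) (Q? ∘ (false ∷_))))
        (+-interchange (both true) (only true) (both false) (only false))
  where
  both only : Bool → ℕ
  both b = count (λ x → P? (b ∷ x) ×-dec Q? (b ∷ x))
  only b = count (λ x → P? (b ∷ x) ×-dec ¬? (Q? (b ∷ x)))

-- Flipping a coordinate permutes F₂ⁿ, so it does not change counts.
count-flip : ∀ {n} (u : Fin n) {P : Vec Bool n → Set} (P? : Decidable P) →
             count (λ x → P? (flip u x)) ≡ count P?
count-flip zero    P? = +-comm (count (P? ∘ (false ∷_))) (count (P? ∘ (true ∷_)))
count-flip (suc u) P? = cong₂ _+_ (count-flip u (P? ∘ (true ∷_))) (count-flip u (P? ∘ (false ∷_)))

FlipInvariant : ∀ {n} → Fin n → (Vec Bool n → Set) → Set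
FlipInvariant u P = ∀ x → P x → P (flip u x)

Toggles : ∀ {n} → Fin n → (Vec Bool n → Bool) → Set
Toggles u ℓ = ∀ x → ℓ (flip u x) ≡ not (ℓ x)

-- Halving: flipping u is a bijection between the vectors of P with ℓ = 0
-- and those with ℓ = 1.
halving : ∀ {n} (u : Fin n) {P : Vec Bool n → Set} (P? : Decidable P) (ℓ : Vec Bool n → Bool) →
          FlipInvariant u P → Toggles u ℓ →
          count P? ≡ 2 * count (λ x → P? x ×-dec (ℓ x ≟ᵇ false))
halving u {P} P? ℓ inv tog = begin
  count P?
    ≡⟨ count-split P? (λ x → ℓ x ≟ᵇ false) ⟩
  zeros + count (λ x → P? x ×-dec ¬? (ℓ x ≟ᵇ false))
    ≡⟨ cong (zeros +_) (count-flip u (λ x → P? x ×-dec ¬? (ℓ x ≟ᵇ false))) ⟨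
  zeros + count (λ x → P? (flip u x) ×-dec ¬? (ℓ (flip u x) ≟ᵇ false))
    ≡⟨ cong (zeros +_) (trans (count-cong flipped⇔) (sym (+-identityʳ zeros))) ⟩
  2 * zeros
    ∎
  where
  zeros : ℕ
  zeros = count (λ x → P? x ×-dec (ℓ x ≟ᵇ false))
  unflip : ∀ x → P (flip u x) → P x
  unflip x p = subst P (flip-involutive u x) (inv (flip u x) p)
  flipped⇔ : ∀ x → (P (flip u x) × ¬ (ℓ (flip u x) ≡ false)) ⇔ (P x × ℓ x ≡ false)
  flipped⇔ x rewrite tog x with ℓ x
  ... | true  = mk⇔ (λ (_ , ¬f) → ⊥-elim (¬f refl)) (λ ())
  ... | false = mk⇔ (λ (p , _) → unflip x p , refl) (λ (p , _) → inv x p , λ ())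

exchange : ∀ {n} (u : Fin n) {P : Vec Bool n → Set} (P? : Decidable P) (ℓ ℓ′ : Vec Bool n → Bool) →
           FlipInvariant u P → Toggles u ℓ → Toggles u ℓ′ →
           count (λ x → P? x ×-dec (ℓ x ≟ᵇ false)) ≡ count (λ x → P? x ×-dec (ℓ′ x ≟ᵇ false))
exchange u P? ℓ ℓ′ inv tog tog′ =
  *-cancelˡ-≡ _ _ 2 (trans (sym (halving u P? ℓ inv tog)) (halving u P? ℓ′ inv tog′))

VanishesOff : ∀ {n} → (Fin n → Set) → (Fin n → Bool) → Set
VanishesOff E e = ∀ y → ¬ E y → e y ≡ false

vanishesOff? : ∀ {n} {E : Fin n → Set} → Decidable E → (e : Fin n → Bool) →
               Dec (VanishesOff E e)
vanishesOff? E? e = all? (λ y → ¬? (E? y) →-dec (e y ≟ᵇ false))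

vanish-transfer : ∀ {n} {E : Fin n → Set} → Decidable E → {Z : Set} {e e′ : Fin n → Bool} →
                  Z ⇔ (∀ y → E y → e y ≡ false) →
                  (Z → ∀ y → ¬ E y → e y ≡ e′ y) →
                  (∀ y → e y ≡ false) ⇔ (VanishesOff E e′ × Z)
vanish-transfer {E = E} E? {Z} {e} {e′} Z⇔ agree = mk⇔ to from
  where
  to : (∀ y → e y ≡ false) → VanishesOff E e′ × Z
  to h = (λ y ¬Ey → trans (sym (agree z y ¬Ey)) (h y)) , z
    where z = Equivalence.from Z⇔ (λ y _ → h y)
  from : VanishesOff E e′ × Z → ∀ y → e y ≡ false
  from (d , z) y with E? y
  ... | yes Ey  = Equivalence.to Z⇔ z y Ey
  ... | no  ¬Ey = trans (agree z y ¬Ey) (d y ¬Ey)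

at-point : ∀ {n} {e : Fin n → Bool} {v : Fin n} {c : Bool} → e v ≡ c →
           (c ≡ false) ⇔ (∀ y → y ≡ v → e y ≡ false)
at-point ev = mk⇔ (λ { c≡f y refl → trans ev c≡f }) (λ h → trans (sym ev) (h _ refl))

at-two-points : ∀ {n} {e : Fin n → Bool} {v₁ v₂ : Fin n} {c₁ c₂ : Bool} →
                e v₁ ≡ c₁ → e v₂ ≡ c₂ →
                (c₁ ≡ false × c₂ ≡ false) ⇔ (∀ y → y ≡ v₁ ⊎ y ≡ v₂ → e y ≡ false)
at-two-points ev₁ ev₂ = mk⇔
  (λ { (c₁≡f , _) y (inj₁ refl) → trans ev₁ c₁≡f ; (_ , c₂≡f) y (inj₂ refl) → trans ev₂ c₂≡f })
  (λ h → trans (sym ev₁) (h _ (inj₁ refl)) , trans (sym ev₂) (h _ (inj₂ refl)))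

delete-same : ∀ {n} (v : Fin n) (T : Fin n → Bool) → delete v T v ≡ false
delete-same v T with v ≟ v
... | yes _   = refl
... | no  v≢v = ⊥-elim (v≢v refl)

delete-other : ∀ {n} {u v : Fin n} (T : Fin n → Bool) → u ≢ v → delete v T u ≡ T u
delete-other {u = u} {v} T u≢v with u ≟ v
... | yes u≡v = ⊥-elim (u≢v u≡v)
... | no  _   = refl

delete-absent : ∀ {n} {u : Fin n} (v : Fin n) (T : Fin n → Bool) → T u ≡ false → delete v T u ≡ false
delete-absent {u = u} v T Tu with u ≟ v
... | yes _ = refl
... | no  _ = Tu

delete-⊆ : ∀ {n} (v : Fin n) (T : Fin n → Bool) {y : Fin n} → delete v T y ≡ true → T y ≡ true
delete-⊆ v T {y} T′y with y ≟ v | T′y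
... | yes _ | ()
... | no  _ | Ty = Ty

delete-cong : ∀ {n} (v : Fin n) {P Q : Fin n → Bool} → (∀ u → P u ≡ Q u) → ∀ u → delete v P u ≡ delete v Q u
delete-cong v P≗Q u with u ≟ v
... | yes _ = refl
... | no  _ = P≗Q u

outside≢inside : ∀ {n} (T : Fin n → Bool) {z v : Fin n} → T z ≡ false → T v ≡ true → z ≢ v
outside≢inside T Tz Tv refl with trans (sym Tz) Tv
... | ()

-- The residual of x for M[T]: (M x)_y at y ∈ T, and x_y at y ∉ T.
-- It vanishes iff x is supported on T and M[T] kills it.
residual : ∀ {n} → Matrix n → (Fin n → Bool) → Vec Bool n → Fin n → Bool
residual M T x y = if T y then (M ∙ x) y else lookup x y

-- x ∈ K(M,T), with vectors indexed by T embedded as vectors supported on T.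
Kernel : ∀ {n} → Matrix n → (Fin n → Bool) → Vec Bool n → Set
Kernel M T x = ∀ y → residual M T x y ≡ false

kernel? : ∀ {n} (M : Matrix n) (T : Fin n → Bool) → Decidable (Kernel M T)
kernel? M T x = all? (λ y → residual M T x y ≟ᵇ false)

kernelSize : ∀ {n} → Matrix n → (Fin n → Bool) → ℕ
kernelSize M T = count (kernel? M T)

residual-inside : ∀ {n} (M : Matrix n) (T : Fin n → Bool) (x : Vec Bool n) {y : Fin n} →
                  T y ≡ true → residual M T x y ≡ (M ∙ x) y
residual-inside M T x {y} Ty = cong (λ b → if b then (M ∙ x) y else lookup x y) Ty

residual-outside : ∀ {n} (M : Matrix n) (T : Fin n → Bool) (x : Vec Bool n) {y : Fin n} →
                   T y ≡ false → residual M T x y ≡ lookup x y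
residual-outside M T x {y} Ty = cong (λ b → if b then (M ∙ x) y else lookup x y) Ty

residual-delete : ∀ {n} (M : Matrix n) (T : Fin n → Bool) (x : Vec Bool n) {y v : Fin n} →
                  y ≢ v → residual M (delete v T) x y ≡ residual M T x y
residual-delete M T x {y} y≢v = cong (λ b → if b then (M ∙ x) y else lookup x y) (delete-other T y≢v)

residual-agree : ∀ {n} (M N : Matrix n) (T : Fin n → Bool) (x : Vec Bool n) {y : Fin n} →
                 (M ∙ x) y ≡ (N ∙ x) y → residual M T x y ≡ residual N T x y
residual-agree M N T x {y} eq = cong (λ b → if T y then b else lookup x y) eq

residual-flip : ∀ {n} (N : Matrix n) (T : Fin n → Bool) (x : Vec Bool n) {u y : Fin n} →
                (T y ≡ true → N y u ≡ false) → y ≢ u →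
                residual N T (flip u x) y ≡ residual N T x y
residual-flip N T x {u} {y} column y≢u with T y
... | true  = ∙-flip-fixes N (column refl) x
... | false = lookup∘updateAt′ y u y≢u x

vanishesOff-flip : ∀ {n} {E : Fin n → Set} (N : Matrix n) (T : Fin n → Bool) {u : Fin n} → E u →
                   (∀ y → T y ≡ true → N y u ≡ false) →
                   FlipInvariant u (λ x → VanishesOff E (residual N T x))
vanishesOff-flip {E = E} N T Eu column x d y ¬Ey =
  trans (residual-flip N T x (column y) (λ { refl → ¬Ey Eu })) (d y ¬Ey)

kernelSize-cong : ∀ {n} (M : Matrix n) {T T′ : Fin n → Bool} → (∀ y → T y ≡ T′ y) →
                  kernelSize M T ≡ kernelSize M T′
kernelSize-cong M T≗T′ = count-cong λ x →
  mk⇔ (λ h y → trans (cong (λ b → if b then (M ∙ x) y else lookup x y) (sym (T≗T′ y))) (h y))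
      (λ h y → trans (cong (λ b → if b then (M ∙ x) y else lookup x y) (T≗T′ y)) (h y))

kernelSize-empty : ∀ {n} (M : Matrix n) → kernelSize M (λ _ → false) ≡ 1
kernelSize-empty M = count-zeroVector (kernel? M (λ _ → false))

-- In the three rule lemmas, D x says that the residual for the reduced
-- matrix vanishes off the removed vertices; the kernel conditions before and
-- after the rule both split as D plus conditions at the removed vertices.

kernel-after-delete : ∀ {n} (N : Matrix n) (T : Fin n → Bool) (v : Fin n) x →
  Kernel N (delete v T) x ⇔ (VanishesOff (_≡ v) (residual N (delete v T) x) × lookup x v ≡ false)
kernel-after-delete N T v x =
  vanish-transfer (_≟ v) {e = residual N (delete v T) x} (at-point (residual-outside N (delete v T) x (delete-same v T)))
                  (λ _ _ _ → refl)

kernelSize-gnr : ∀ {n} (M : Matrix n) (T : Fin n → Bool) (v : Fin n) → Symmetric M →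
                 T v ≡ true → (∀ w → T w ≡ true → M v w ≡ false) →
                 kernelSize M T ≡ 2 * kernelSize M (delete v T)
kernelSize-gnr {n} M T v symM Tv row = begin
  kernelSize M T              ≡⟨ count-cong before ⟩
  count D?                    ≡⟨ halving v D? (λ x → lookup x v) D-flip (λ x → lookup∘updateAt v x) ⟩
  2 * count (λ x → D? x ×-dec (lookup x v ≟ᵇ false))
                              ≡⟨ cong (2 *_) (count-cong (kernel-after-delete M T v)) ⟨
  2 * kernelSize M (delete v T) ∎
  where
  D : Vec Bool n → Set
  D x = VanishesOff (_≡ v) (residual M (delete v T) x)
  D? : Decidable D
  D? x = vanishesOff? (_≟ v) (residual M (delete v T) x)
  D-flip : FlipInvariant v D
  D-flip = vanishesOff-flip M (delete v T) refl (λ y T′y → trans (symM y v) (row y (delete-⊆ v T T′y)))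
  -- Given D, row v of M already annihilates x, so D is the whole kernel condition.
  row-vanishes : ∀ x → D x → (M ∙ x) v ≡ false
  row-vanishes x d = ·-vanishes (M v) x term
    where
    term : ∀ z → M v z ∧ lookup x z ≡ false
    term z with T z in Tz
    ... | true  = cong (_∧ lookup x z) (row z Tz)
    ... | false = trans (cong (M v z ∧_) xz) (∧-zeroʳ (M v z))
      where
      z≢v : z ≢ v
      z≢v = outside≢inside T Tz Tv
      xz : lookup x z ≡ false
      xz = trans (sym (trans (residual-delete M T x z≢v) (residual-outside M T x Tz))) (d z z≢v)
  before : ∀ x → Kernel M T x ⇔ D x
  before x = mk⇔ (proj₁ ∘ to) (λ d → from (d , row-vanishes x d))
    where
    open Equivalence (vanish-transfer (_≟ v) {e = residual M T x} {e′ = residual M (delete v T) x}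
                        (at-point (residual-inside M T x Tv)) (λ _ y y≢v → sym (residual-delete M T x y≢v)))

kernelSize-gpr : ∀ {n} (M : Matrix n) (T : Fin n → Bool) (v : Fin n) → Symmetric M →
                 T v ≡ true → M v v ≡ true →
                 kernelSize M T ≡ kernelSize (pivot₁ M v) (delete v T)
kernelSize-gpr {n} M T v symM Tv Mvv = begin
  kernelSize M T                                      ≡⟨ count-cong before ⟩
  count (λ x → D? x ×-dec ((M ∙ x) v ≟ᵇ false))
    ≡⟨ exchange v D? (λ x → (M ∙ x) v) (λ x → lookup x v) D-flip
         (∙-flip-toggles M Mvv) (λ x → lookup∘updateAt v x) ⟩
  count (λ x → D? x ×-dec (lookup x v ≟ᵇ false))      ≡⟨ count-cong (kernel-after-delete M′ T v) ⟨
  kernelSize M′ (delete v T)                          ∎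
  where
  M′ = pivot₁ M v
  D : Vec Bool n → Set
  D x = VanishesOff (_≡ v) (residual M′ (delete v T) x)
  D? : Decidable D
  D? x = vanishesOff? (_≟ v) (residual M′ (delete v T) x)
  D-flip : FlipInvariant v D
  D-flip = vanishesOff-flip M′ (delete v T) refl (λ y _ → pivot₁-column M v symM Mvv y)
  before : ∀ x → Kernel M T x ⇔ (D x × (M ∙ x) v ≡ false)
  before x = vanish-transfer (_≟ v) {e = residual M T x} {e′ = residual M′ (delete v T) x}
                             (at-point (residual-inside M T x Tv)) same-off-v
    where
    same-off-v : (M ∙ x) v ≡ false → ∀ y → y ≢ v → residual M T x y ≡ residual M′ (delete v T) x y
    same-off-v rv y y≢v = trans (residual-agree M M′ T x (sym (pivot₁-invisible M v x rv y)))
                               (sym (residual-delete M′ T x y≢v))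

-- Two exchanges trade (M x)_{v₂} = 0 for x_{v₁} = 0
-- (flipping v₁) and then (M x)_{v₁} = 0 for x_{v₂} = 0 (flipping v₂).
kernelSize-gdr : ∀ {n} (M : Matrix n) (T : Fin n → Bool) (v₁ v₂ : Fin n) → Symmetric M → v₁ ≢ v₂ →
                 T v₁ ≡ true → T v₂ ≡ true → M v₁ v₁ ≡ false → M v₂ v₂ ≡ false → M v₁ v₂ ≡ true →
                 kernelSize M T ≡ kernelSize (pivot₂ M v₁ v₂) (delete v₂ (delete v₁ T))
kernelSize-gdr {n} M T v₁ v₂ symM v₁≢v₂ Tv₁ Tv₂ M₁₁ M₂₂ M₁₂ = begin
  kernelSize M T
    ≡⟨ count-cong before ⟩
  count (λ x → (D? x ×-dec (r₁ x ≟ᵇ false)) ×-dec (r₂ x ≟ᵇ false))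
    ≡⟨ exchange v₁ (λ x → D? x ×-dec (r₁ x ≟ᵇ false)) r₂ x₁ flip₁-invariant
         (∙-flip-toggles M M₂₁) (λ x → lookup∘updateAt v₁ x) ⟩
  count (λ x → (D? x ×-dec (r₁ x ≟ᵇ false)) ×-dec (x₁ x ≟ᵇ false))
    ≡⟨ count-cong {n} (λ x → mk⇔ swap swap) ⟩
  count (λ x → (D? x ×-dec (x₁ x ≟ᵇ false)) ×-dec (r₁ x ≟ᵇ false))
    ≡⟨ exchange v₂ (λ x → D? x ×-dec (x₁ x ≟ᵇ false)) r₁ x₂ flip₂-invariant
         (∙-flip-toggles M M₁₂) (λ x → lookup∘updateAt v₂ x) ⟩
  count (λ x → (D? x ×-dec (x₁ x ≟ᵇ false)) ×-dec (x₂ x ≟ᵇ false))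
    ≡⟨ count-cong after ⟨
  kernelSize M″ T″
    ∎
  where
  M″ = pivot₂ M v₁ v₂
  T″ = delete v₂ (delete v₁ T)
  M₂₁ : M v₂ v₁ ≡ true
  M₂₁ = trans (symM v₂ v₁) M₁₂
  r₁ r₂ x₁ x₂ : Vec Bool n → Bool
  r₁ x = (M ∙ x) v₁
  r₂ x = (M ∙ x) v₂
  x₁ x = lookup x v₁
  x₂ x = lookup x v₂
  Pivot : Fin n → Set
  Pivot y = y ≡ v₁ ⊎ y ≡ v₂
  pivot? : Decidable Pivot
  pivot? y = (y ≟ v₁) ⊎-dec (y ≟ v₂)
  D : Vec Bool n → Set
  D x = VanishesOff Pivot (residual M″ T″ x)
  D? : Decidable D
  D? x = vanishesOff? pivot? (residual M″ T″ x)
  flip₁-invariant : FlipInvariant v₁ (λ x → D x × r₁ x ≡ false)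
  flip₁-invariant x (d , e) =
    vanishesOff-flip M″ T″ (inj₁ refl) (λ y _ → pivot₂-column₁ M v₁ v₂ symM M₁₁ M₂₁ y) x d ,
    trans (∙-flip-fixes M M₁₁ x) e
  flip₂-invariant : FlipInvariant v₂ (λ x → D x × x₁ x ≡ false)
  flip₂-invariant x (d , e) =
    vanishesOff-flip M″ T″ (inj₂ refl) (λ y _ → pivot₂-column₂ M v₁ v₂ symM M₂₂ M₁₂ y) x d ,
    trans (lookup∘updateAt′ v₁ v₂ v₁≢v₂ x) e
  swap : ∀ {A B C : Set} → (A × B) × C → (A × C) × B
  swap ((a , b) , c) = (a , c) , b
  regroup : ∀ {A B C E : Set} → A ⇔ (B × (C × E)) → A ⇔ ((B × C) × E)
  regroup A⇔ = mk⇔ (λ a → let (b , c , e) = to a in (b , c) , e) (λ ((b , c) , e) → from (b , c , e))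
    where open Equivalence A⇔
  before : ∀ x → Kernel M T x ⇔ ((D x × r₁ x ≡ false) × r₂ x ≡ false)
  before x = regroup (vanish-transfer pivot? {e = residual M T x} {e′ = residual M″ T″ x}
    (at-two-points (residual-inside M T x Tv₁) (residual-inside M T x Tv₂)) same-off-pivots)
    where
    same-off-pivots : r₁ x ≡ false × r₂ x ≡ false → ∀ y → ¬ Pivot y → residual M T x y ≡ residual M″ T″ x y
    same-off-pivots (e₁ , e₂) y ¬pivot = trans
      (residual-agree M M″ T x (sym (pivot₂-invisible M v₁ v₂ x e₁ e₂ y)))
      (sym (trans (residual-delete M″ (delete v₁ T) x (¬pivot ∘ inj₂)) (residual-delete M″ T x (¬pivot ∘ inj₁))))
  after : ∀ x → Kernel M″ T″ x ⇔ ((D x × x₁ x ≡ false) × x₂ x ≡ false)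
  after x = regroup (vanish-transfer pivot? {e = residual M″ T″ x}
    (at-two-points (residual-outside M″ T″ x (delete-absent v₂ (delete v₁ T) (delete-same v₁ T)))
                   (residual-outside M″ T″ x (delete-same v₂ (delete v₁ T))))
    (λ _ _ _ → refl))

Active : ∀ {n} → State n → (Fin n → Bool) → Fin n → Bool
Active S W u = present S u ∧ W u

Active-delete : ∀ {n} (v : Fin n) (P W : Fin n → Bool) u →
                delete v P u ∧ W u ≡ delete v (λ w → P w ∧ W w) u
Active-delete v P W u with u ≟ v
... | yes _ = refl
... | no  _ = refl

step-absent : ∀ {n} {S S′ : State n} {γ : Rule n} → Step S γ S′ →
              ∀ {u} → present S u ≡ false → present S′ u ≡ false
step-absent {S = S} (gpr-step {v} _ _)                 absent = delete-absent v (present S) absent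
step-absent {S = S} (gdr-step {v₁} {v₂} _ _ _ _ _ _)   absent =
  delete-absent v₂ (delete v₁ (present S)) (delete-absent v₁ (present S) absent)
step-absent {S = S} (gnr-step {v} _ _ _)               absent = delete-absent v (present S) absent

run-absent : ∀ {n} {S F : State n} {σ : List (Rule n)} → Run S σ F →
             ∀ {u} → present S u ≡ false → present F u ≡ false
run-absent done         absent = absent
run-absent (step st rn) absent = run-absent rn (step-absent st absent)

removed-in-domain : ∀ {n} {S F : State n} {σ : List (Rule n)} (W : Fin n → Bool) → Run S σ F →
                    HasDomain F W → ∀ u → present S u ≡ false → W u ≡ true
removed-in-domain W rn dom u absent = not-injective (trans (sym (dom u)) (run-absent rn absent))

kernel-invariant : ∀ {n} (W : Fin n → Bool) {S F : State n} {σ : List (Rule n)} → Run S σ F →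
                   Symmetric (adj S) → HasDomain F W → kernelSize (adj S) (Active S W) ≡ 2 ^ countGnr σ
kernel-invariant W {S} done _ dom = begin
  kernelSize (adj S) (Active S W)  ≡⟨ kernelSize-cong (adj S) (λ u → trans (cong (_∧ W u) (dom u)) (∧-inverseˡ (W u))) ⟩
  kernelSize (adj S) (λ _ → false) ≡⟨ kernelSize-empty (adj S) ⟩
  1                                ∎
kernel-invariant W {S} {σ = _ ∷ σ} (step (gpr-step {v} pv Mvv) rn) symM dom = begin
  kernelSize M (Active S W)
    ≡⟨ kernelSize-gpr M (Active S W) v symM (cong₂ _∧_ pv (removed-in-domain W rn dom v (delete-same v (present S)))) Mvv ⟩
  kernelSize (pivot₁ M v) (delete v (Active S W))
    ≡⟨ kernelSize-cong (pivot₁ M v) (λ u → sym (Active-delete v (present S) W u)) ⟩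
  kernelSize (pivot₁ M v) (Active (gprResult S v) W)
    ≡⟨ kernel-invariant W rn (pivot₁-symmetric M v symM) dom ⟩
  2 ^ countGnr σ
    ∎
  where M = adj S
kernel-invariant W {S} {σ = _ ∷ σ} (step (gdr-step {v₁} {v₂} v₁≢v₂ pv₁ pv₂ M₁₁ M₂₂ M₁₂) rn) symM dom = begin
  kernelSize M (Active S W)
    ≡⟨ kernelSize-gdr M (Active S W) v₁ v₂ symM v₁≢v₂ (cong₂ _∧_ pv₁ W₁) (cong₂ _∧_ pv₂ W₂) M₁₁ M₂₂ M₁₂ ⟩
  kernelSize (pivot₂ M v₁ v₂) (delete v₂ (delete v₁ (Active S W)))
    ≡⟨ kernelSize-cong (pivot₂ M v₁ v₂) (λ u → sym (trans (Active-delete v₂ (delete v₁ (present S)) W u)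
                                                        (delete-cong v₂ (Active-delete v₁ (present S) W) u))) ⟩
  kernelSize (pivot₂ M v₁ v₂) (Active (gdrResult S v₁ v₂) W)
    ≡⟨ kernel-invariant W rn (pivot₂-symmetric M v₁ v₂ symM) dom ⟩
  2 ^ countGnr σ
    ∎
  where
  M = adj S
  W₁ : W v₁ ≡ true
  W₁ = removed-in-domain W rn dom v₁ (delete-absent v₂ (delete v₁ (present S)) (delete-same v₁ (present S)))
  W₂ : W v₂ ≡ true
  W₂ = removed-in-domain W rn dom v₂ (delete-same v₂ (delete v₁ (present S)))
kernel-invariant W {S} {σ = _ ∷ σ} (step (gnr-step {v} pv Mvv isolated) rn) symM dom = begin
  kernelSize M (Active S W)
    ≡⟨ kernelSize-gnr M (Active S W) v symM (cong₂ _∧_ pv (removed-in-domain W rn dom v (delete-same v (present S)))) row ⟩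
  2 * kernelSize M (delete v (Active S W))
    ≡⟨ cong (2 *_) (kernelSize-cong M (λ u → sym (Active-delete v (present S) W u))) ⟩
  2 * kernelSize M (Active (gnrResult S v) W)
    ≡⟨ cong (2 *_) (kernel-invariant W rn symM dom) ⟩
  2 * 2 ^ countGnr σ
    ∎
  where
  M = adj S
  row : ∀ w → Active S W w ≡ true → M v w ≡ false
  row w active-w with w ≟ v
  ... | yes refl = Mvv
  ... | no  w≢v  = isolated w (∧-conicalˡ _ _ active-w) w≢v

2^-injective : ∀ a b → 2 ^ a ≡ 2 ^ b → a ≡ b
2^-injective a b eq with <-cmp a b
... | tri< a<b _ _ = ⊥-elim (<-irrefl eq (^-monoʳ-< 2 (s≤s (s≤s z≤n)) a<b))
... | tri≈ _ a≡b _ = a≡b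
... | tri> _ _ b<a = ⊥-elim (<-irrefl (sym eq) (^-monoʳ-< 2 (s≤s (s≤s z≤n)) b<a))

mainTheorem12 : (n : ℕ) (A : Matrix n) → Symmetric A → (W : Fin n → Bool) →
    (σ τ : List (Rule n)) (F₁ F₂ : State n) →
    Run (initial A) σ F₁ → HasDomain F₁ W →
    Run (initial A) τ F₂ → HasDomain F₂ W →
    countGnr σ ≡ countGnr τ
mainTheorem12 n A symA W σ τ F₁ F₂ run₁ dom₁ run₂ dom₂ = 2^-injective _ _ (begin
  2 ^ countGnr σ                       ≡⟨ kernel-invariant W run₁ symA dom₁ ⟨
  kernelSize A (Active (initial A) W)  ≡⟨ kernel-invariant W run₂ symA dom₂ ⟩
  2 ^ countGnr τ                       ∎)
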